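{- Let $M$ be a skew-symmetric or symmetric $V\times V$ matrix over a field $\mathbb{F}$. Let $N$ be a Lagrangian chain-group on $V$ to $K=\mathbb{F}^2$ such that $(M,a,b)$ is a matrix representation of $N$ with supplementary chains $a$ and $b$ on $V$ to $K$. Then for every $X\subseteq V$, \[\operatorname{rk}M[X,V\setminus X]=\lambda_N(X)=|X|-\dim(N\times X).\]
   Context: Skew-symmetric means $M=-M^t$ with all diagonal entries zero; symmetric means $M=M^t$. $K=\mathbb{F}^2$ carries a bilinear form $\langle\,,\,\rangle_K$ equal to $b^+(\binom ab,\binom cd)=ad+bc$ (symmetric) or $b^-(\binom ab,\binom cd)=ad-bc$ (skew-symmetric). Chains on $V$ to $K$ are maps $V\to K$, forming $K^V$ with $\langle f,g\rangle=\sum_x\langle f(x),g(x)\rangle_K$; a chain-group is a subspace of $K^V$; Lagrangian means $\langle f,g\rangle=0$ for all $f,g\in N$ and $\dim N=|V|$. Chains $a,b$ are supplementary if $\langle a(x),a(x)\rangle_K=\langle b(x),b(x)\rangle_K=0$ and $\langle a(x),b(x)\rangle_K=1$ for all $x\in V$. Given $M=(m_{ij})$ skew-symmetric or symmetric and supplementary $a,b$, where $\langle\,,\,\rangle_K$ is skew-symmetric if $M$ is symmetric and symmetric if $M$ is skew-symmetric, let $f_i(i)=m_{ii}a(i)+b(i)$ and $f_i(j)=m_{ij}a(j)$ for $j\ne i$; the span of $\{f_i:i\in V\}$ is a Lagrangian chain-group $N$, and $(M,a,b)$ is called a (general) matrix representation of $N$. $N\times X=\{f\cdot X: f\in N, f(x)=0\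 \forall x\notin X\}$ where $f\cdot X$ is restriction, and $\lambda_N(X)=\frac12(\dim N-\dim(N\times(V\setminus X))-\dim(N\times X))$. -}

module Defs where

open import Level using (Level; _⊔_) renaming (suc to lsuc)
open import Algebra.Bundles using (CommutativeRing)
open import Data.Nat using (ℕ; zero; suc)
open import Data.Fin using (Fin; zero; suc; _≟_)
open import Data.Fin.Subset using (Subset; _∈_; _∉_; ∁)
open import Data.Product using (Σ; ∃; _×_; _,_; proj₁; proj₂)
open import Data.Sum using (_⊎_)
open import Relation.Nullary using (¬_; yes; no)
open import Relation.Binary.PropositionalEquality using (_≡_)

record Field (c ℓ : Level) : Set (lsuc (c ⊔ ℓ)) where
  field
    commutativeRing : CommutativeRing c ℓ
  open CommutativeRing commutativeRing public
  field
    1≉0     : ¬ (1# ≈ 0#)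
    inverse : ∀ x → ¬ (x ≈ 0#) → Σ Carrier (λ y → x * y ≈ 1#)

module _ {c ℓ : Level} (F : Field c ℓ) where
  open Field F using (Carrier; _≈_; _+_; _*_; -_; _-_; 0#; 1#)

  record Module : Set (lsuc (c ⊔ ℓ)) where
    field
      A    : Set c
      _≈A_ : A → A → Set ℓ
      _+A_ : A → A → A
      0A   : A
      _·A_ : Carrier → A → A

  module Lin (Mo : Module) {I : Set} where
    open Module Mo

    lc : (d : ℕ) → (Fin d → Carrier) → (Fin d → I → A) → I → A
    lc zero    cs g i = 0A
    lc (suc d) cs g i = (cs zero ·A g zero i) +A lc d (λ k → cs (suc k)) (λ k → g (suc k)) i

    InSpan : {J : Set} → (J → I → A) → (I → A) → Set (c ⊔ ℓ)
    InSpan {J} g v = Σ ℕ λ d → Σ (Fin d → Carrier) λ cs → Σ (Fin d → J) λ js →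
                     ∀ i → v i ≈A lc d cs (λ k → g (js k)) i

    Independent : (d : ℕ) → (Fin d → I → A) → Set (c ⊔ ℓ)
    Independent d g = ∀ (cs : Fin d → Carrier) → (∀ i → lc d cs g i ≈A 0A) → ∀ k → cs k ≈ 0#

    IsDim : ((I → A) → Set (c ⊔ ℓ)) → ℕ → Set (c ⊔ ℓ)
    IsDim S d = Σ (Fin d → I → A) λ g →
                (∀ k → S (g k)) × Independent d g × (∀ v → S v → InSpan g v)

  FMod : Module
  FMod = record { A = Carrier ; _≈A_ = _≈_ ; _+A_ = _+_ ; 0A = 0# ; _·A_ = _*_ }

  K : Set c
  K = Carrier × Carrier

  _≈K_ : K → K → Set ℓ
  (x , y) ≈K (u , v) = (x ≈ u) × (y ≈ v)

  _+K_ : K → K → K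
  (x , y) +K (u , v) = (x + u , y + v)

  0K : K
  0K = (0# , 0#)

  _·K_ : Carrier → K → K
  s ·K (x , y) = (s * x , s * y)

  KMod : Module
  KMod = record { A = K ; _≈A_ = _≈K_ ; _+A_ = _+K_ ; 0A = 0K ; _·A_ = _·K_ }

  data FormType : Set where
    symm skew : FormType

  ⟨_⟩K : FormType → K → K → Carrier
  ⟨ symm ⟩K (a , b) (c' , d) = (a * d) + (b * c')
  ⟨ skew ⟩K (a , b) (c' , d) = (a * d) - (b * c')

  Matrix : ℕ → Set c
  Matrix n = Fin n → Fin n → Carrier

  IsSymmetric : ∀ {n} → Matrix n → Set ℓ
  IsSymmetric M = ∀ i j → M i j ≈ M j i

  IsSkewSymmetric : ∀ {n} → Matrix n → Set ℓ
  IsSkewSymmetric M = (∀ i j → M i j ≈ - M j i) × (∀ i → M i i ≈ 0#)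

  Compatible : ∀ {n} → Matrix n → FormType → Set ℓ
  Compatible M t = (IsSymmetric M × t ≡ skew) ⊎ (IsSkewSymmetric M × t ≡ symm)

  Chain : ℕ → Set c
  Chain n = Fin n → K

  Supplementary : ∀ {n} → FormType → Chain n → Chain n → Set ℓ
  Supplementary t a b = ∀ x → (⟨ t ⟩K (a x) (a x) ≈ 0#) × (⟨ t ⟩K (b x) (b x) ≈ 0#)
                              × (⟨ t ⟩K (a x) (b x) ≈ 1#)

  repChain : ∀ {n} → Matrix n → Chain n → Chain n → Fin n → Chain n
  repChain M a b i j with i ≟ j
  ... | yes _ = (M i i ·K a i) +K b i
  ... | no  _ = M i j ·K a j

  RepGroup : ∀ {n} → Matrix n → Chain n → Chain n → Chain n → Set (c ⊔ ℓ)
  RepGroup {n} M a b = Lin.InSpan KMod {Fin n} (repChain M a b)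

  El : ∀ {n} → Subset n → Set
  El {n} X = Σ (Fin n) (λ x → x ∈ X)

  Minor : ∀ {n} → (Chain n → Set (c ⊔ ℓ)) → (X : Subset n) → (El X → K) → Set (c ⊔ ℓ)
  Minor {n} N X h = Σ (Chain n) λ f → N f × (∀ x → x ∉ X → f x ≈K 0K)
                                        × (∀ p → h p ≈K f (proj₁ p))

  subMatrix : ∀ {n} → Matrix n → (X : Subset n) → El X → El (∁ X) → Carrier
  subMatrix M X r s = M (proj₁ r) (proj₁ s)

  IsRank : {R C : Set} → (R → C → Carrier) → ℕ → Set (c ⊔ ℓ)
  IsRank {R} {C} A r = Lin.IsDim FMod {R} (Lin.InSpan FMod {R} {C} (λ s rr → A rr s)) r

module Submission where

-- A chain g = α a + β b is determined by its b-coordinate β(x) = ⟨a(x), g(x)⟩: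
-- on N the a-coordinate is α = βᵀ M.  Hence N ≅ F^V, so dim N = |V|, and
-- N × Z ≅ {γ ∈ F^Z : γᵀ M[Z, V∖Z] = 0}.  For Z = X this is the left kernel of
-- A = M[X, V∖X]; for Z = V∖X it is, since M = ±Mᵀ, the kernel of A.
-- Rank–nullity for A, and for Aᵀ together with "row rank = column rank", give
-- the two identities |X| = rk A + dim (N × X), |V∖X| = rk A + dim (N × (V∖X)).
--
-- The field has an arbitrary setoid equality, so the case distinctions (in the
-- Steinitz exchange lemma and in extracting a basis of the row space) are made
-- under double negation, which is harmless for conclusions in ℕ; extracting a
-- basis moreover needs a ¬¬-stable equality and is done in the field F¬¬
-- whose equality is the double negation of that of F.

open import Defs
open import Level using (Level; _⊔_)
open import Algebra.Bundles using (Monoid)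
open import Algebra.Structures using (IsCommutativeRing)
open import Data.Empty using (⊥-elim)
open import Data.Nat as ℕ using (ℕ; zero; suc; _≤_; z≤n; s≤s)
import Data.Nat.Properties as ℕ
open import Data.Nat.Tactic.RingSolver using (solve-∀)
open import Data.Fin as Fin using (Fin; zero; suc; punchIn; _↑ˡ_; _↑ʳ_; splitAt; join)
open import Data.Fin.Properties using (punchInᵢ≢i; all?; ¬∀⟶∃¬; join-splitAt)
open import Data.Fin.Subset using (Subset; _∈_; _∉_; ∁; ∣_∣; inside; outside)
open import Data.Fin.Subset.Properties
  using (_∈?_; ∣p∣≤n; ∣∁p∣≡n∸∣p∣; x∈p⇒x∉∁p; x∉p⇒x∈∁p; x∈∁p⇒x∉p; x∉∁p⇒x∈p)
open import Data.Vec.Properties.WithK using ([]=-irrelevant)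
open import Data.Vec.Functional.Properties using (insertAt-lookup; insertAt-punchIn; lookup-++ˡ; lookup-++ʳ)
open import Data.Product using (Σ; _×_; _,_; proj₁; proj₂)
open import Data.Sum using (inj₁; inj₂)
open import Data.Unit using (⊤; tt)
open import Function.Bundles using (_↔_; Inverse; mk↔ₛ′)
open import Function.Construct.Identity using (↔-id)
open import Relation.Nullary using (¬_; Dec; yes; no; ¬¬-map; negated-stable)
open import Relation.Nullary.Decidable using (decidable-stable; ¬¬-excluded-middle)
open import Relation.Binary.PropositionalEquality as ≡ using (_≡_; _≢_)

private
  variable
    a b p : Level
    A B : Set a

-- Since ℕ-equalities are decidable, ¬¬-conclusions about dimensions can
-- be turned back into actual equalities (decidable-stable).

pure : A → ¬ ¬ A
pure x ¬x = ¬x x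

infixl 1 _>>=_
_>>=_ : ¬ ¬ A → (A → ¬ ¬ B) → ¬ ¬ B
(m >>= f) ¬b = m (λ x → f x ¬b)

¬¬-Π : ∀ n {P : Fin n → Set p} → (∀ i → ¬ ¬ P i) → ¬ ¬ (∀ i → P i)
¬¬-Π zero    h = pure λ ()
¬¬-Π (suc n) h = h zero >>= λ p₀ → ¬¬-Π n (λ i → h (suc i)) >>= λ ps →
  pure λ { zero → p₀ ; (suc i) → ps i }

¬¬-Π-finite : ∀ {J : Set} {q} → Fin q ↔ J → {P : J → Set p} → (∀ x → ¬ ¬ P x) → ¬ ¬ (∀ x → P x)
¬¬-Π-finite {q = q} E {P} h = ¬¬-Π q (λ t → h (to t)) >>= λ f →
  pure λ x → ≡.subst P (strictlyInverseˡ x) (f (from x))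
  where open Inverse E

module Subsets where
  open import Data.Vec using ([]; _∷_; here; there)

  -- The elements of a subset Z ⊆ Fin n, as an index type; definitionally
  -- the type El F Z of Defs (which does not depend on F).
  Elem : ∀ {n} → Subset n → Set
  Elem {n} Z = Σ (Fin n) (_∈ Z)

  private
    enum : ∀ {n} (Z : Subset n) → Fin ∣ Z ∣ → Elem Z
    enum (inside  ∷ Z) zero    = zero , here
    enum (inside  ∷ Z) (suc t) = let (x , x∈Z) = enum Z t in suc x , there x∈Z
    enum (outside ∷ Z) t       = let (x , x∈Z) = enum Z t in suc x , there x∈Z

    index : ∀ {n} (Z : Subset n) → Elem Z → Fin ∣ Z ∣
    index (inside  ∷ Z) (zero  , here)    = zero
    index (inside  ∷ Z) (suc x , there p) = suc (index Z (x , p))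
    index (outside ∷ Z) (suc x , there p) = index Z (x , p)

    enum-index : ∀ {n} (Z : Subset n) (x : Elem Z) → enum Z (index Z x) ≡ x
    enum-index (inside  ∷ Z) (zero  , here)    = ≡.refl
    enum-index (inside  ∷ Z) (suc x , there p) = ≡.cong (λ (y , q) → suc y , there q) (enum-index Z (x , p))
    enum-index (outside ∷ Z) (suc x , there p) = ≡.cong (λ (y , q) → suc y , there q) (enum-index Z (x , p))

    index-enum : ∀ {n} (Z : Subset n) (t : Fin ∣ Z ∣) → index Z (enum Z t) ≡ t
    index-enum (inside  ∷ Z) zero    = ≡.refl
    index-enum (inside  ∷ Z) (suc t) = ≡.cong suc (index-enum Z t)
    index-enum (outside ∷ Z) t       = index-enum Z t

  enumeration : ∀ {n} (Z : Subset n) → Fin ∣ Z ∣ ↔ Elem Z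
  enumeration Z = mk↔ₛ′ (enum Z) (index Z) (enum-index Z) (index-enum Z)

  ∣Z∣+∣∁Z∣≡n : ∀ {n} (Z : Subset n) → ∣ Z ∣ ℕ.+ ∣ ∁ Z ∣ ≡ n
  ∣Z∣+∣∁Z∣≡n Z = ≡.trans (≡.cong (∣ Z ∣ ℕ.+_) (∣∁p∣≡n∸∣p∣ Z)) (ℕ.m+[n∸m]≡n (∣p∣≤n Z))

  module _ {c ℓ : Level} (Mon : Monoid c ℓ) where
    open Monoid Mon
    open import Algebra.Properties.Monoid.Sum Mon using (sum)

    sum-over-subset : ∀ {n} (Z : Subset n) (g : Fin n → Carrier) → (∀ x → x ∉ Z → g x ≈ ε) →
                      sum g ≈ sum (λ t → g (proj₁ (Inverse.to (enumeration Z) t)))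
    sum-over-subset []            g h = refl
    sum-over-subset (inside  ∷ Z) g h =
      ∙-congˡ (sum-over-subset Z (λ x → g (suc x)) (λ x x∉Z → h (suc x) λ { (there x∈Z) → x∉Z x∈Z }))
    sum-over-subset (outside ∷ Z) g h = trans (∙-congʳ (h zero λ ())) (trans (identityˡ _)
      (sum-over-subset Z (λ x → g (suc x)) (λ x x∉Z → h (suc x) λ { (there x∈Z) → x∉Z x∈Z })))

open Subsets public

module LinearAlgebra {c ℓ : Level} (F : Field c ℓ) where
  open Field F hiding (zero)
  open import Data.Vec.Functional using (insertAt; _++_; _∷_)
  open import Algebra.Properties.Ring ring using (-‿distribˡ-*; -‿distribʳ-*; -1*x≈-x; +-inverseˡ-unique)
  open import Algebra.Properties.Semiring.Sum semiring
    using (sum; sum-cong-≋; ∑-distrib-+; ∑-comm; *-distribˡ-sum; *-distribʳ-sum; sum-remove; sum-replicate-zero)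
  open import Relation.Binary.Reasoning.Setoid setoid

  infix 8 _∙_
  _∙_ : ∀ {d} → (Fin d → Carrier) → (Fin d → Carrier) → Carrier
  cs ∙ v = sum (λ k → cs k * v k)

  module _ {d : ℕ} where
    ∙-cong : ∀ {cs cs' v v' : Fin d → Carrier} → (∀ k → cs k ≈ cs' k) → (∀ k → v k ≈ v' k) →
             cs ∙ v ≈ cs' ∙ v'
    ∙-cong e f = sum-cong-≋ {d} (λ k → *-cong (e k) (f k))

    ∙-zeroʳ : ∀ (cs : Fin d → Carrier) {v} → (∀ k → v k ≈ 0#) → cs ∙ v ≈ 0#
    ∙-zeroʳ cs e = trans (sum-cong-≋ {d} (λ k → trans (*-cong refl (e k)) (zeroʳ (cs k)))) (sum-replicate-zero d)

    ∙-zeroˡ : ∀ {cs} (v : Fin d → Carrier) → (∀ k → cs k ≈ 0#) → cs ∙ v ≈ 0#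
    ∙-zeroˡ v e = trans (sum-cong-≋ {d} (λ k → trans (*-cong (e k) refl) (zeroˡ (v k)))) (sum-replicate-zero d)

    ∙-+ˡ : ∀ (cs cs' v : Fin d → Carrier) → (λ k → cs k + cs' k) ∙ v ≈ cs ∙ v + cs' ∙ v
    ∙-+ˡ cs cs' v = trans (sum-cong-≋ {d} (λ k → distribʳ (v k) (cs k) (cs' k)))
                          (∑-distrib-+ (λ k → cs k * v k) (λ k → cs' k * v k))

    ∙-+ʳ : ∀ (cs v w : Fin d → Carrier) → cs ∙ (λ k → v k + w k) ≈ cs ∙ v + cs ∙ w
    ∙-+ʳ cs v w = trans (sum-cong-≋ {d} (λ k → distribˡ (cs k) (v k) (w k)))
                        (∑-distrib-+ (λ k → cs k * v k) (λ k → cs k * w k))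

    ∙-*ˡ : ∀ s (cs v : Fin d → Carrier) → (λ k → s * cs k) ∙ v ≈ s * (cs ∙ v)
    ∙-*ˡ s cs v = trans (sum-cong-≋ {d} (λ k → *-assoc s (cs k) (v k)))
                        (sym (*-distribˡ-sum s (λ k → cs k * v k)))

    ∙-*ʳ : ∀ (cs v : Fin d → Carrier) x → cs ∙ (λ k → v k * x) ≈ (cs ∙ v) * x
    ∙-*ʳ cs v x = trans (sum-cong-≋ {d} (λ k → sym (*-assoc (cs k) (v k) x)))
                        (sym (*-distribʳ-sum x (λ k → cs k * v k)))

    ∙-neg : ∀ (cs v : Fin d → Carrier) → (λ k → - cs k) ∙ v ≈ - (cs ∙ v)
    ∙-neg cs v = begin
      (λ k → - cs k) ∙ v         ≈⟨ ∙-cong (λ k → sym (-1*x≈-x (cs k))) (λ _ → refl) ⟩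
      (λ k → - 1# * cs k) ∙ v    ≈⟨ ∙-*ˡ (- 1#) cs v ⟩
      - 1# * (cs ∙ v)            ≈⟨ -1*x≈-x _ ⟩
      - (cs ∙ v)                 ∎

    ∙-comm : ∀ (cs v : Fin d → Carrier) → cs ∙ v ≈ v ∙ cs
    ∙-comm cs v = sum-cong-≋ {d} (λ k → *-comm (cs k) (v k))

  ∙-remove : ∀ {d} (k : Fin (suc d)) (cs v : Fin (suc d) → Carrier) →
             cs ∙ v ≈ cs k * v k + (λ j → cs (punchIn k j)) ∙ (λ j → v (punchIn k j))
  ∙-remove k cs v = sum-remove {i = k} (λ j → cs j * v j)

  ∙-assoc : ∀ {d p} (cs : Fin d → Carrier) (μ : Fin d → Fin p → Carrier) (z : Fin p → Carrier) →
            cs ∙ (λ k → μ k ∙ z) ≈ (λ l → cs ∙ (λ k → μ k l)) ∙ z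
  ∙-assoc {d} {p} cs μ z = begin
    sum (λ k → cs k * sum (λ l → μ k l * z l))
      ≈⟨ sum-cong-≋ {d} (λ k → *-distribˡ-sum (cs k) (λ l → μ k l * z l)) ⟩
    sum (λ k → sum (λ l → cs k * (μ k l * z l)))
      ≈⟨ ∑-comm (λ k l → cs k * (μ k l * z l)) ⟩
    sum (λ l → sum (λ k → cs k * (μ k l * z l)))
      ≈⟨ sum-cong-≋ {p} (λ l → sum-cong-≋ {d} (λ k → sym (*-assoc (cs k) (μ k l) (z l)))) ⟩
    sum (λ l → sum (λ k → (cs k * μ k l) * z l))
      ≈⟨ sum-cong-≋ {p} (λ l → sym (*-distribʳ-sum (z l) (λ k → cs k * μ k l))) ⟩
    sum (λ l → sum (λ k → cs k * μ k l) * z l)        ∎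

  δ : ∀ {m} → Fin m → Fin m → Carrier
  δ k l with k Fin.≟ l
  ... | yes _ = 1#
  ... | no  _ = 0#

  δ-diag : ∀ {m} (k : Fin m) → δ k k ≈ 1#
  δ-diag k with k Fin.≟ k
  ... | yes _  = refl
  ... | no k≢k = ⊥-elim (k≢k ≡.refl)

  δ-off : ∀ {m} {k l : Fin m} → k ≢ l → δ k l ≈ 0#
  δ-off {k = k} {l} k≢l with k Fin.≟ l
  ... | yes k≡l = ⊥-elim (k≢l k≡l)
  ... | no  _   = refl

  δ-∙ : ∀ {m} (k : Fin m) (v : Fin m → Carrier) → δ k ∙ v ≈ v k
  δ-∙ {suc m} k v = begin
    δ k ∙ v                                                  ≈⟨ ∙-remove k (δ k) v ⟩
    δ k k * v k + (λ j → δ k (punchIn k j)) ∙ (λ j → v (punchIn k j))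
      ≈⟨ +-cong (*-cong (δ-diag k) refl) (∙-zeroˡ _ (λ j → δ-off (λ k≡ → punchInᵢ≢i k j (≡.sym k≡)))) ⟩
    1# * v k + 0#                                            ≈⟨ trans (+-identityʳ _) (*-identityˡ _) ⟩
    v k                                                      ∎

  ∙-δ : ∀ {m} (k : Fin m) (v : Fin m → Carrier) → v ∙ (λ l → δ l k) ≈ v k
  ∙-δ {suc m} k v = begin
    v ∙ (λ l → δ l k)                                        ≈⟨ ∙-remove k v (λ l → δ l k) ⟩
    v k * δ k k + (λ j → v (punchIn k j)) ∙ (λ j → δ (punchIn k j) k)
      ≈⟨ +-cong (*-cong refl (δ-diag k)) (∙-zeroʳ _ (λ j → δ-off (punchInᵢ≢i k j))) ⟩
    v k * 1# + 0#                                            ≈⟨ trans (+-identityʳ _) (*-identityʳ _) ⟩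
    v k                                                      ∎

  pivot-cancel : ∀ a b ι → b * ι ≈ 1# → a + (- (a * ι)) * b ≈ 0#
  pivot-cancel a b ι bι≈1 = begin
    a + (- (a * ι)) * b     ≈⟨ +-cong refl (sym (-‿distribˡ-* (a * ι) b)) ⟩
    a + - ((a * ι) * b)     ≈⟨ +-cong refl (-‿cong (*-assoc a ι b)) ⟩
    a + - (a * (ι * b))     ≈⟨ +-cong refl (-‿cong (*-cong refl (trans (*-comm ι b) bι≈1))) ⟩
    a + - (a * 1#)          ≈⟨ +-cong refl (-‿cong (*-identityʳ a)) ⟩
    a + - a                 ≈⟨ -‿inverseʳ a ⟩
    0#                      ∎

  module _ {I : Set} where

    lc : (d : ℕ) → (Fin d → Carrier) → (Fin d → I → Carrier) → I → Carrier
    lc = Lin.lc F (FMod F) {I}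

    Independent : (d : ℕ) → (Fin d → I → Carrier) → Set (c ⊔ ℓ)
    Independent = Lin.Independent F (FMod F) {I}

    InSpan : {J : Set} → (J → I → Carrier) → (I → Carrier) → Set (c ⊔ ℓ)
    InSpan = Lin.InSpan F (FMod F) {I}

    lc≈∙ : ∀ d cs (g : Fin d → I → Carrier) i → lc d cs g i ≈ cs ∙ (λ k → g k i)
    lc≈∙ zero    cs g i = refl
    lc≈∙ (suc d) cs g i = +-cong refl (lc≈∙ d (λ k → cs (suc k)) (λ k → g (suc k)) i)

    independent : ∀ {d} {g : Fin d → I → Carrier} → Independent d g →
                  ∀ cs → (∀ i → cs ∙ (λ k → g k i) ≈ 0#) → ∀ k → cs k ≈ 0#
    independent {d} {g} ind cs z = ind cs (λ i → trans (lc≈∙ d cs g i) (z i))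

    mk-independent : ∀ {d} {g : Fin d → I → Carrier} →
                     (∀ cs → (∀ i → cs ∙ (λ k → g k i) ≈ 0#) → ∀ k → cs k ≈ 0#) → Independent d g
    mk-independent {d} {g} h cs z = h cs (λ i → trans (sym (lc≈∙ d cs g i)) (z i))

    Combination : ∀ {m} → (Fin m → I → Carrier) → (I → Carrier) → Set (c ⊔ ℓ)
    Combination {m} w v = Σ (Fin m → Carrier) λ κ → ∀ i → v i ≈ κ ∙ (λ l → w l i)

    combination-member : ∀ {m} (w : Fin m → I → Carrier) k → Combination w (w k)
    combination-member w k = δ k , λ i → sym (δ-∙ k (λ l → w l i))

    combination⇒span : ∀ {m} {w : Fin m → I → Carrier} {v} → Combination w v → InSpan w v
    combination⇒span {m} {w} (κ , e) = m , κ , (λ l → l) , λ i → trans (e i) (sym (lc≈∙ m κ w i))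

    span⇒combination : ∀ {J : Set} {m} {g : J → I → Carrier} {v} (z : Fin m → I → Carrier) →
                       InSpan g v → (∀ j → Combination z (g j)) → Combination z v
    span⇒combination {g = g} {v} z (d , cs , js , e) gz =
      (λ l → cs ∙ (λ t → κ t l)) , λ i → begin
        v i                                          ≈⟨ trans (e i) (lc≈∙ d cs _ i) ⟩
        cs ∙ (λ t → g (js t) i)                      ≈⟨ ∙-cong (λ _ → refl) (λ t → proj₂ (gz (js t)) i) ⟩
        cs ∙ (λ t → κ t ∙ (λ l → z l i))             ≈⟨ ∙-assoc cs κ (λ l → z l i) ⟩
        (λ l → cs ∙ (λ t → κ t l)) ∙ (λ l → z l i)   ∎
      where
      κ : Fin d → Fin _ → Carrier
      κ t = proj₁ (gz (js t))

    combination-trans : ∀ {m p} {g : Fin m → I → Carrier} {v} (z : Fin p → I → Carrier) →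
                        Combination g v → (∀ j → Combination z (g j)) → Combination z v
    combination-trans z gv = span⇒combination z (combination⇒span gv)

    drop-first : ∀ {m} {w : Fin (suc m) → I → Carrier} {v} (cv : Combination w v) →
                 proj₁ cv zero ≈ 0# → Combination (λ l → w (suc l)) v
    drop-first (κ , e) κ₀≈0 = (λ l → κ (suc l)) , λ i →
      trans (e i) (trans (+-cong (trans (*-cong κ₀≈0 refl) (zeroˡ _)) refl) (+-identityˡ _))

    combination-shift : ∀ {m} {w : Fin (suc m) → I → Carrier} {v} →
                        Combination (λ l → w (suc l)) v → Combination w v
    combination-shift (κ , e) = (0# ∷ κ) , λ i →
      trans (e i) (sym (trans (+-cong (zeroˡ _) refl) (+-identityˡ _)))

    combination-axpy : ∀ {m} {w : Fin m → I → Carrier} {v v'} → (cv : Combination w v) → (cv' : Combination w v') →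
                       ∀ s → Combination w (λ i → v i + s * v' i)
    combination-axpy {w = w} {v} {v'} (κ , e) (κ' , e') s = (λ l → κ l + s * κ' l) , λ i → begin
      v i + s * v' i                                   ≈⟨ +-cong (e i) (*-cong refl (e' i)) ⟩
      κ ∙ (λ l → w l i) + s * (κ' ∙ (λ l → w l i))     ≈⟨ +-cong refl (sym (∙-*ˡ s κ' _)) ⟩
      κ ∙ (λ l → w l i) + (λ l → s * κ' l) ∙ (λ l → w l i)   ≈⟨ sym (∙-+ˡ κ _ _) ⟩
      (λ l → κ l + s * κ' l) ∙ (λ l → w l i)           ∎

    independent-eliminate : ∀ {d} {u : Fin (suc d) → I → Carrier} (k : Fin (suc d)) (s : Fin d → Carrier) →
                            Independent (suc d) u →
                            Independent d (λ j i → u (punchIn k j) i + s j * u k i)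
    independent-eliminate {d} {u} k s ind = mk-independent λ cs z j →
      trans (reflexive (≡.sym (insertAt-punchIn cs k (cs ∙ s) j)))
            (independent {g = u} ind (insertAt cs k (cs ∙ s)) (vanishes cs z) (punchIn k j))
      where
      vanishes : ∀ cs → (∀ i → cs ∙ (λ j → u (punchIn k j) i + s j * u k i) ≈ 0#) →
                 ∀ i → insertAt cs k (cs ∙ s) ∙ (λ l → u l i) ≈ 0#
      vanishes cs z i = begin
        cs' ∙ (λ l → u l i)
          ≈⟨ ∙-remove k cs' (λ l → u l i) ⟩
        cs' k * u k i + (λ j → cs' (punchIn k j)) ∙ (λ j → u (punchIn k j) i)
          ≈⟨ +-cong (*-cong (reflexive (insertAt-lookup cs k (cs ∙ s))) refl)
                    (∙-cong (λ j → reflexive (insertAt-punchIn cs k (cs ∙ s) j)) (λ _ → refl)) ⟩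
        (cs ∙ s) * u k i + cs ∙ (λ j → u (punchIn k j) i)
          ≈⟨ trans (+-comm _ _) (+-cong refl (sym (∙-*ʳ cs s (u k i)))) ⟩
        cs ∙ (λ j → u (punchIn k j) i) + cs ∙ (λ j → s j * u k i)
          ≈⟨ sym (∙-+ʳ cs _ _) ⟩
        cs ∙ (λ j → u (punchIn k j) i + s j * u k i)
          ≈⟨ z i ⟩
        0#  ∎
        where
        cs' : Fin (suc d) → Carrier
        cs' = insertAt cs k (cs ∙ s)

    -- Steinitz exchange lemma: d independent combinations of m vectors
    -- force d ≤ m.  Deciding which coefficients vanish is classical, so the
    -- conclusion is double-negated.
    steinitz : ∀ m {d} (w : Fin m → I → Carrier) (u : Fin d → I → Carrier) →
               Independent d u → (∀ j → Combination w (u j)) → ¬ ¬ (d ≤ m)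
    steinitz m       {zero}  w u ind uw = pure z≤n
    steinitz zero    {suc d} w u ind uw = λ _ →
      1≉0 (independent {g = u} ind (λ _ → 1#) (λ i → ∙-zeroʳ (λ _ → 1#) (λ j → proj₂ (uw j) i)) zero)
    steinitz (suc m) {suc d} w u ind uw =
      ¬¬-Π (suc d) {P = λ j → Dec (κ₀ j ≈ 0#)} (λ _ → ¬¬-excluded-middle) >>= λ dec →
      exchange dec (all? dec)
      where
      κ₀ : Fin (suc d) → Carrier
      κ₀ j = proj₁ (uw j) zero

      exchange : (∀ j → Dec (κ₀ j ≈ 0#)) → Dec (∀ j → κ₀ j ≈ 0#) → ¬ ¬ (suc d ≤ suc m)
      exchange _   (yes κ₀≈0) = ¬¬-map ℕ.m≤n⇒m≤1+n
        (steinitz m (λ l → w (suc l)) u ind (λ j → drop-first {w = w} (uw j) (κ₀≈0 j)))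
      -- pivot on some u k using w zero, and eliminate w zero from the other u j
      exchange dec (no ¬κ₀≈0) = pivot (¬∀⟶∃¬ (suc d) _ dec ¬κ₀≈0)
        where
        pivot : Σ (Fin (suc d)) (λ k → ¬ κ₀ k ≈ 0#) → ¬ ¬ (suc d ≤ suc m)
        pivot (k , κ₀k≉0) = ¬¬-map s≤s
          (steinitz m (λ l → w (suc l)) u' (independent-eliminate {u = u} k (λ j → - μ j) ind) u'w)
          where
          ι : Carrier
          ι = proj₁ (inverse (κ₀ k) κ₀k≉0)
          κ₀kι≈1 : κ₀ k * ι ≈ 1#
          κ₀kι≈1 = proj₂ (inverse (κ₀ k) κ₀k≉0)
          μ : Fin d → Carrier
          μ j = κ₀ (punchIn k j) * ι
          u' : Fin d → I → Carrier
          u' j i = u (punchIn k j) i + (- μ j) * u k i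
          u'w : ∀ j → Combination (λ l → w (suc l)) (u' j)
          u'w j = drop-first {w = w} (combination-axpy {w = w} (uw (punchIn k j)) (uw k) (- μ j))
                             (pivot-cancel (κ₀ (punchIn k j)) (κ₀ k) ι κ₀kι≈1)

    same-size : ∀ {d e} (g : Fin d → I → Carrier) (h : Fin e → I → Carrier) →
                Independent d g → Independent e h →
                (∀ k → ¬ ¬ Combination h (g k)) → (∀ k → ¬ ¬ Combination g (h k)) → d ≡ e
    same-size {d} {e} g h g-ind h-ind gh hg = decidable-stable (d ℕ.≟ e) (
      ¬¬-Π d gh >>= λ gh' → ¬¬-Π e hg >>= λ hg' →
      steinitz e h g g-ind gh' >>= λ d≤e → steinitz d g h h-ind hg' >>= λ e≤d →
      pure (ℕ.≤-antisym d≤e e≤d))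

  ++-suc : ∀ {a} {V : Set a} {r s} (u : Fin (suc r) → V) (z : Fin s → V) k →
           (u ++ z) (suc k) ≡ ((λ l → u (suc l)) ++ z) k
  ++-suc {r = r} u z k with splitAt r k
  ... | inj₁ _ = ≡.refl
  ... | inj₂ _ = ≡.refl

  ∙-++ : ∀ {a} {V : Set a} r {s} (cs : Fin (r ℕ.+ s) → Carrier) (f : V → Carrier) (u : Fin r → V) (z : Fin s → V) →
         cs ∙ (λ k → f ((u ++ z) k)) ≈
         (λ k → cs (k ↑ˡ s)) ∙ (λ k → f (u k)) + (λ k → cs (r ↑ʳ k)) ∙ (λ k → f (z k))
  ∙-++ zero    cs f u z = sym (+-identityˡ _)
  ∙-++ (suc r) cs f u z = begin
    cs zero * f (u zero) + (λ k → cs (suc k)) ∙ (λ k → f ((u ++ z) (suc k)))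
      ≈⟨ +-cong refl (∙-cong (λ _ → refl) (λ k → reflexive (≡.cong f (++-suc u z k)))) ⟩
    cs zero * f (u zero) + (λ k → cs (suc k)) ∙ (λ k → f (((λ l → u (suc l)) ++ z) k))
      ≈⟨ +-cong refl (∙-++ r (λ k → cs (suc k)) f (λ l → u (suc l)) z) ⟩
    cs zero * f (u zero) + ((λ k → cs (suc (k ↑ˡ _))) ∙ (λ k → f (u (suc k)))
                            + (λ k → cs (suc r ↑ʳ k)) ∙ (λ k → f (z k)))
      ≈⟨ sym (+-assoc _ _ _) ⟩
    (λ k → cs (k ↑ˡ _)) ∙ (λ k → f (u k)) + (λ k → cs (suc r ↑ʳ k)) ∙ (λ k → f (z k))  ∎

  split-∀ : ∀ {p} r {s} {P : Fin (r ℕ.+ s) → Set p} →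
            (∀ k → P (k ↑ˡ s)) → (∀ k → P (r ↑ʳ k)) → ∀ k → P k
  split-∀ r {s} {P} left right k = ≡.subst P (join-splitAt r s k) (by-side (splitAt r k))
    where
    by-side : ∀ x → P (join r s x)
    by-side (inj₁ k') = left k'
    by-side (inj₂ k') = right k'

  module _ {I : Set} where

    -- Weak dimension: a basis of the subspace S whose spanning property only
    -- holds up to double negation.  This is what survives a change of the
    -- equality of F to its double negation (see DoubleNegationField).
    IsDim¬¬ : ∀ {p} → ((I → Carrier) → Set p) → ℕ → Set (c ⊔ ℓ ⊔ p)
    IsDim¬¬ S d = Σ (Fin d → I → Carrier) λ g →
                  (∀ k → S (g k)) × Independent d g × (∀ v → S v → ¬ ¬ InSpan g v)

    IsDim⇒IsDim¬¬ : ∀ {S d} → Lin.IsDim F (FMod F) S d → IsDim¬¬ S d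
    IsDim⇒IsDim¬¬ (g , g∈S , g-ind , g-span) = g , g∈S , g-ind , λ v v∈S → pure (g-span v v∈S)

    IsDim¬¬-cong : ∀ {p p'} {S : (I → Carrier) → Set p} {S' : (I → Carrier) → Set p'} {d} →
                   (∀ v → S v → S' v) → (∀ v → S' v → S v) → IsDim¬¬ S d → IsDim¬¬ S' d
    IsDim¬¬-cong S⊆S' S'⊆S (g , g∈S , g-ind , g-span) =
      g , (λ k → S⊆S' (g k) (g∈S k)) , g-ind , λ v v∈S' → g-span v (S'⊆S v v∈S')

  ColumnSpace : ∀ {R C : Set} → (R → C → Carrier) → (R → Carrier) → Set (c ⊔ ℓ)
  ColumnSpace A = InSpan (λ y x → A x y)

  transpose : ∀ {R C : Set} → (R → C → Carrier) → C → R → Carrier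
  transpose A y x = A x y

  module Finite {J : Set} {q : ℕ} (E : Fin q ↔ J) where
    open Inverse E using (strictlyInverseˡ; strictlyInverseʳ) renaming (to to enum; from to index)

    unit : Fin q → J → Carrier
    unit t j = δ t (index j)

    unit-independent : Independent q unit
    unit-independent = mk-independent λ cs z t → begin
      cs t                            ≈⟨ sym (∙-δ t cs) ⟩
      cs ∙ (λ l → δ l t)
        ≈⟨ ∙-cong (λ _ → refl) (λ l → reflexive (≡.cong (δ l) (≡.sym (strictlyInverseʳ t)))) ⟩
      cs ∙ (λ l → unit l (enum t))    ≈⟨ z (enum t) ⟩
      0#                              ∎

    coordinates : ∀ (γ : J → Carrier) → Combination unit γ
    coordinates γ = (λ t → γ (enum t)) , λ j → begin
      γ j                                          ≈⟨ reflexive (≡.cong γ (≡.sym (strictlyInverseˡ j))) ⟩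
      γ (enum (index j))                           ≈⟨ sym (∙-δ (index j) (λ t → γ (enum t))) ⟩
      (λ t → γ (enum t)) ∙ (λ t → δ t (index j))   ∎

    full-dimension : ∀ {p} {S : (J → Carrier) → Set p} {d} → IsDim¬¬ S d → (∀ γ → S γ) → d ≡ q
    full-dimension (g , _ , g-ind , g-span) everything =
      same-size g unit g-ind unit-independent (λ k → pure (coordinates (g k)))
        (λ t → ¬¬-map (λ t∈⟨g⟩ → span⇒combination g t∈⟨g⟩ (combination-member g))
                      (g-span (unit t) (everything (unit t))))

    module _ {I : Set} (g : J → I → Carrier) where
      span⇒combination-enum : ∀ {v} → InSpan g v → Combination (λ t → g (enum t)) v
      span⇒combination-enum v∈ = span⇒combination (λ t → g (enum t)) v∈ λ j →
        δ (index j) , λ i → trans (reflexive (≡.cong (λ j' → g j' i) (≡.sym (strictlyInverseˡ j))))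
                                  (sym (δ-∙ (index j) (λ t → g (enum t) i)))

      combination-enum⇒span : ∀ {v} → Combination (λ t → g (enum t)) v → InSpan g v
      combination-enum⇒span (κ , e) = q , κ , enum , λ i → trans (e i) (sym (lc≈∙ q κ _ i))

    infixl 7 _·_
    _·_ : ∀ {R : Set} → (R → J → Carrier) → (J → Carrier) → R → Carrier
    (A · γ) x = (λ t → γ (enum t)) ∙ (λ t → A x (enum t))

    Kernel : ∀ {R : Set} → (R → J → Carrier) → (J → Carrier) → Set ℓ
    Kernel A γ = ∀ x → (A · γ) x ≈ 0#

    module _ {R : Set} (A : R → J → Carrier) where

      ·-cong : ∀ {γ γ'} → (∀ j → γ j ≈ γ' j) → ∀ x → (A · γ) x ≈ (A · γ') x
      ·-cong e x = ∙-cong (λ t → e (enum t)) (λ _ → refl)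

      ·-linear : ∀ {d} {γ} (cs : Fin d → Carrier) (γs : Fin d → J → Carrier) →
                 (∀ j → γ j ≈ cs ∙ (λ k → γs k j)) → ∀ x → (A · γ) x ≈ cs ∙ (λ k → (A · γs k) x)
      ·-linear cs γs e x = trans (·-cong e x) (sym (∙-assoc cs (λ k t → γs k (enum t)) (λ t → A x (enum t))))

      image⊆column-space : ∀ γ → ColumnSpace A (A · γ)
      image⊆column-space γ = combination-enum⇒span (λ y x → A x y) ((λ t → γ (enum t)) , λ _ → refl)

      column-space⇒image : ∀ {v} → ColumnSpace A v → Σ (J → Carrier) λ γ → ∀ x → (A · γ) x ≈ v x
      column-space⇒image v∈col = (λ j → κ (index j)) , λ x →
        trans (∙-cong (λ t → reflexive (≡.cong κ (strictlyInverseʳ t))) (λ _ → refl)) (sym (e x))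
        where open Σ (span⇒combination-enum (λ y x → A x y) v∈col) renaming (proj₁ to κ; proj₂ to e)

      module _ {r s} (u : Fin r → J → Carrier) (w : Fin r → R → Carrier) (z : Fin s → J → Carrier)
               (Au≈w : ∀ k x → (A · u k) x ≈ w k x) (z∈ker : ∀ k → Kernel A (z k)) where

        -- preimages u of an independent family w, followed by an independent
        -- family z in the kernel, are independent: apply A to kill z first
        preimages++kernel-independent : Independent r w → Independent s z → Independent (r ℕ.+ s) (u ++ z)
        preimages++kernel-independent w-ind z-ind =
          mk-independent λ cs vanish → split-∀ r (on-u cs vanish) (on-z cs vanish)
          where
          on-u : ∀ cs → (∀ j → cs ∙ (λ k → (u ++ z) k j) ≈ 0#) → ∀ k → cs (k ↑ˡ s) ≈ 0#
          on-u cs vanish = independent {g = w} w-ind _ λ x → begin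
            (λ k → cs (k ↑ˡ s)) ∙ (λ k → w k x)
              ≈⟨ sym (trans (+-cong (∙-cong (λ _ → refl) (λ k → Au≈w k x)) (∙-zeroʳ _ (λ k → z∈ker k x)))
                            (+-identityʳ _)) ⟩
            (λ k → cs (k ↑ˡ s)) ∙ (λ k → (A · u k) x) + (λ k → cs (r ↑ʳ k)) ∙ (λ k → (A · z k) x)
              ≈⟨ sym (∙-++ r cs (λ γ → (A · γ) x) u z) ⟩
            cs ∙ (λ k → (A · (u ++ z) k) x)
              ≈⟨ sym (·-linear cs (u ++ z) (λ _ → refl) x) ⟩
            (A · (λ j → cs ∙ (λ k → (u ++ z) k j))) x
              ≈⟨ ∙-zeroˡ _ (λ t → vanish (enum t)) ⟩
            0#  ∎
          on-z : ∀ cs → (∀ j → cs ∙ (λ k → (u ++ z) k j) ≈ 0#) → ∀ k → cs (r ↑ʳ k) ≈ 0#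
          on-z cs vanish = independent {g = z} z-ind _ λ j → begin
            (λ k → cs (r ↑ʳ k)) ∙ (λ k → z k j)
              ≈⟨ sym (trans (+-cong (∙-zeroˡ _ (on-u cs vanish)) refl) (+-identityˡ _)) ⟩
            (λ k → cs (k ↑ˡ s)) ∙ (λ k → u k j) + (λ k → cs (r ↑ʳ k)) ∙ (λ k → z k j)
              ≈⟨ sym (∙-++ r cs (λ γ → γ j) u z) ⟩
            cs ∙ (λ k → (u ++ z) k j)
              ≈⟨ vanish j ⟩
            0#  ∎

        -- if w spans the column space and z the kernel, then u ++ z spans F^J:
        -- γ minus the preimage of (the combination of w giving) A·γ lies in the kernel
        preimages++kernel-spanning : (∀ v → ColumnSpace A v → ¬ ¬ InSpan w v) →
                                     (∀ γ → Kernel A γ → ¬ ¬ InSpan z γ) →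
                                     ∀ γ → ¬ ¬ Combination (u ++ z) γ
        preimages++kernel-spanning w-span z-span γ =
          w-span (A · γ) (image⊆column-space γ) >>= λ Aγ∈⟨w⟩ →
          let (c₁ , Aγ≈c₁w) = span⇒combination w Aγ∈⟨w⟩ (combination-member w)
              γ' : J → Carrier
              γ' j = γ j + - (c₁ ∙ (λ k → u k j))
              γ'∈ker : Kernel A γ'
              γ'∈ker x = begin
                (A · γ') x
                  ≈⟨ ·-linear (1# ∷ λ k → - c₁ k) (γ ∷ u)
                       (λ j → +-cong (sym (*-identityˡ _)) (sym (∙-neg c₁ (λ k → u k j)))) x ⟩
                1# * (A · γ) x + (λ k → - c₁ k) ∙ (λ k → (A · u k) x)
                  ≈⟨ +-cong (trans (*-identityˡ _) (Aγ≈c₁w x))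
                            (trans (∙-neg c₁ _) (-‿cong (∙-cong (λ _ → refl) (λ k → Au≈w k x)))) ⟩
                c₁ ∙ (λ k → w k x) + - (c₁ ∙ (λ k → w k x))
                  ≈⟨ -‿inverseʳ _ ⟩
                0#  ∎
          in z-span γ' γ'∈ker >>= λ γ'∈⟨z⟩ →
          let (c₂ , γ'≈c₂z) = span⇒combination z γ'∈⟨z⟩ (combination-member z)
          in pure ((c₁ ++ c₂) , λ j → begin
            γ j
              ≈⟨ sym (trans (+-assoc _ _ _) (trans (+-cong refl (-‿inverseˡ _)) (+-identityʳ _))) ⟩
            γ' j + c₁ ∙ (λ k → u k j)
              ≈⟨ trans (+-comm _ _) (+-cong refl (γ'≈c₂z j)) ⟩
            c₁ ∙ (λ k → u k j) + c₂ ∙ (λ k → z k j)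
              ≈⟨ sym (+-cong (∙-cong (λ k → reflexive (lookup-++ˡ c₁ c₂ k)) (λ _ → refl))
                             (∙-cong (λ k → reflexive (lookup-++ʳ c₁ c₂ k)) (λ _ → refl))) ⟩
            (λ k → (c₁ ++ c₂) (k ↑ˡ s)) ∙ (λ k → u k j) + (λ k → (c₁ ++ c₂) (r ↑ʳ k)) ∙ (λ k → z k j)
              ≈⟨ sym (∙-++ r (c₁ ++ c₂) (λ γ → γ j) u z) ⟩
            (c₁ ++ c₂) ∙ (λ k → (u ++ z) k j)  ∎)

      -- Rank–nullity: dim (column space) + dim (kernel) = number of columns,
      -- since preimages of a basis of the column space followed by a basis of
      -- the kernel form a basis of F^J.
      rank-nullity : ∀ {r s} → IsDim¬¬ (ColumnSpace A) r → IsDim¬¬ (Kernel A) s → r ℕ.+ s ≡ q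
      rank-nullity {r} (w , w∈col , w-ind , w-span) (z , z∈ker , z-ind , z-span) =
        same-size (u ++ z) unit (preimages++kernel-independent u w z Au≈w z∈ker w-ind z-ind) unit-independent
                  (λ k → pure (coordinates ((u ++ z) k)))
                  (λ t → preimages++kernel-spanning u w z Au≈w z∈ker w-span z-span (unit t))
        where
        u : Fin r → J → Carrier
        u k = proj₁ (column-space⇒image (w∈col k))
        Au≈w : ∀ k x → (A · u k) x ≈ w k x
        Au≈w k = proj₂ (column-space⇒image (w∈col k))

  -- Column rank ≤ row rank, for a matrix with finitely many rows: every row is
  -- a combination of a row basis h, so every column is a combination of the
  -- r₂ vectors formed by the coefficients.
  column-rank≤row-rank : ∀ {R C : Set} {p r₁ r₂} → Fin p ↔ R → (A : R → C → Carrier) →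
                         IsDim¬¬ (ColumnSpace A) r₁ → IsDim¬¬ (ColumnSpace (transpose A)) r₂ → ¬ ¬ (r₁ ≤ r₂)
  column-rank≤row-rank {r₂ = r₂} E A (g , g∈col , g-ind , _) (h , _ , _ , h-span) =
    ¬¬-Π-finite E (λ x → ¬¬-map (λ A[x]∈⟨h⟩ → span⇒combination h A[x]∈⟨h⟩ (combination-member h))
                                (h-span (A x) (row∈row-space x))) >>= λ rows →
    let D : Fin r₂ → _ → Carrier
        D j x = proj₁ (rows x) j
        column∈⟨D⟩ : ∀ y → Combination D (λ x → A x y)
        column∈⟨D⟩ y = (λ j → h j y) , λ x → trans (proj₂ (rows x) y) (∙-comm (λ j → D j x) (λ j → h j y))
    in steinitz r₂ D g g-ind (λ k → span⇒combination D (g∈col k) column∈⟨D⟩)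
    where
    row∈row-space : ∀ x → ColumnSpace (transpose A) (A x)
    row∈row-space x = 1 , (λ _ → 1#) , (λ _ → x) , λ y → sym (trans (+-identityʳ _) (*-identityˡ _))

  module StableEquality (stable : ∀ {x y} → ¬ ¬ (x ≈ y) → x ≈ y) where

    module _ {I : Set} where
      independent-extend : ∀ {d} {b : Fin d → I → Carrier} {v} →
                           Independent d b → ¬ Combination b v → Independent (suc d) (v ∷ b)
      independent-extend {d} {b} {v} b-ind v∉⟨b⟩ = mk-independent {g = v ∷ b} λ cs vanish →
        let cs₀≈0 : cs zero ≈ 0#
            cs₀≈0 = stable λ cs₀≉0 →
              let (ι , cs₀ι≈1) = inverse (cs zero) cs₀≉0
              in v∉⟨b⟩ ((λ k → - (ι * cs (suc k))) , λ i → begin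
                v i
                  ≈⟨ sym (trans (*-cong (trans (*-comm ι _) cs₀ι≈1) refl) (*-identityˡ _)) ⟩
                (ι * cs zero) * v i
                  ≈⟨ *-assoc _ _ _ ⟩
                ι * (cs zero * v i)
                  ≈⟨ *-cong refl (+-inverseˡ-unique _ _ (vanish i)) ⟩
                ι * - ((λ k → cs (suc k)) ∙ (λ k → b k i))
                  ≈⟨ sym (-‿distribʳ-* ι _) ⟩
                - (ι * ((λ k → cs (suc k)) ∙ (λ k → b k i)))
                  ≈⟨ -‿cong (sym (∙-*ˡ ι (λ k → cs (suc k)) (λ k → b k i))) ⟩
                - ((λ k → ι * cs (suc k)) ∙ (λ k → b k i))
                  ≈⟨ sym (∙-neg (λ k → ι * cs (suc k)) (λ k → b k i)) ⟩
                (λ k → - (ι * cs (suc k))) ∙ (λ k → b k i)  ∎)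
            tail≈0 : ∀ k → cs (suc k) ≈ 0#
            tail≈0 = independent {g = b} b-ind _ λ i →
              trans (sym (trans (+-cong (trans (*-cong cs₀≈0 refl) (zeroˡ _)) refl) (+-identityˡ _))) (vanish i)
        in λ { zero → cs₀≈0 ; (suc k) → tail≈0 k }

      Basis : ∀ {m} → (Fin m → I → Carrier) → Set (c ⊔ ℓ)
      Basis g = Σ ℕ λ d → Σ (Fin d → I → Carrier) λ b →
                (∀ k → Combination g (b k)) × Independent d b × (∀ j → Combination b (g j))

      -- scan g from the end, keeping each vector not in the span of those kept
      basis : ∀ m (g : Fin m → I → Carrier) → ¬ ¬ Basis g
      basis zero    g = pure (0 , (λ ()) , (λ ()) , (λ _ _ ()) , (λ ()))
      basis (suc m) g = basis m (λ k → g (suc k)) >>= λ (d , b , b∈⟨g⟩ , b-ind , g∈⟨b⟩) →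
        ¬¬-excluded-middle >>= λ where
          (yes g₀∈⟨b⟩) → pure (d , b , (λ k → combination-shift {w = g} (b∈⟨g⟩ k)) , b-ind ,
                               λ { zero → g₀∈⟨b⟩ ; (suc j) → g∈⟨b⟩ j })
          (no g₀∉⟨b⟩)  → pure (suc d , (g zero ∷ b) ,
                               (λ { zero → combination-member g zero ; (suc k) → combination-shift {w = g} (b∈⟨g⟩ k) }) ,
                               independent-extend b-ind g₀∉⟨b⟩ ,
                               λ { zero → combination-member (g zero ∷ b) zero
                                 ; (suc j) → combination-shift {w = g zero ∷ b} (g∈⟨b⟩ j) })

      span-dimension : ∀ {J : Set} {q} → Fin q ↔ J → (g : J → I → Carrier) → ¬ ¬ Σ ℕ (IsDim¬¬ (InSpan g))
      span-dimension {q = q} E g = basis q (λ t → g (enum t)) >>= λ (d , b , b∈⟨g⟩ , b-ind , g∈⟨b⟩) →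
        pure (d , b , (λ k → combination-enum⇒span g (b∈⟨g⟩ k)) , b-ind ,
              λ v v∈⟨g⟩ → pure (combination⇒span (combination-trans b (span⇒combination-enum g v∈⟨g⟩) g∈⟨b⟩)))
        where open Finite E using (span⇒combination-enum; combination-enum⇒span)
              open Inverse E using () renaming (to to enum)

    -- Rank plus left nullity is the number of rows: the row space has a
    -- dimension, equal to the rank, and rank–nullity applies to the transpose.
    rank+left-nullity : ∀ {R C : Set} {p q r s} (ER : Fin p ↔ R) (EC : Fin q ↔ C) (A : R → C → Carrier) →
                        IsDim¬¬ (ColumnSpace A) r → IsDim¬¬ (Finite.Kernel ER (transpose A)) s → r ℕ.+ s ≡ p
    rank+left-nullity {p = p} {r = r} {s} ER EC A rank left-nullity = decidable-stable (r ℕ.+ s ℕ.≟ p) (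
      span-dimension ER A >>= λ (ρ , row-rank) →
      column-rank≤row-rank ER A rank row-rank >>= λ r≤ρ →
      column-rank≤row-rank EC (transpose A) row-rank rank >>= λ ρ≤r →
      pure (≡.subst (λ x → x ℕ.+ s ≡ p) (ℕ.≤-antisym ρ≤r r≤ρ)
                    (Finite.rank-nullity ER (transpose A) row-rank left-nullity)))

-- Its equality is ¬¬-stable, so the stable-equality results
-- of LinearAlgebra apply to it, and weak dimensions move from F to it.
module DoubleNegationField {c ℓ : Level} (F : Field c ℓ) where
  open Field F hiding (zero)

  _≈¬¬_ : Carrier → Carrier → Set ℓ
  x ≈¬¬ y = ¬ ¬ (x ≈ y)

  private
    lift₂ : ∀ {f : Carrier → Carrier → Carrier} → (∀ {x y u v} → x ≈ y → u ≈ v → f x u ≈ f y v) →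
            ∀ {x y u v} → x ≈¬¬ y → u ≈¬¬ v → f x u ≈¬¬ f y v
    lift₂ cong₂ x≈y u≈v = x≈y >>= λ x≈y → u≈v >>= λ u≈v → pure (cong₂ x≈y u≈v)

    isCommutativeRing¬¬ : IsCommutativeRing _≈¬¬_ _+_ _*_ -_ 0# 1#
    isCommutativeRing¬¬ = record
      { isRing = record
        { +-isAbelianGroup = record
          { isGroup = record
            { isMonoid = record
              { isSemigroup = record
                { isMagma = record
                  { isEquivalence = record
                    { refl  = pure refl
                    ; sym   = λ x≈y → x≈y >>= λ x≈y → pure (sym x≈y)
                    ; trans = λ x≈y y≈z → x≈y >>= λ x≈y → y≈z >>= λ y≈z → pure (trans x≈y y≈z) }
                  ; ∙-cong = lift₂ +-cong }
                ; assoc = λ x y z → pure (+-assoc x y z) }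
              ; identity = (λ x → pure (+-identityˡ x)) , (λ x → pure (+-identityʳ x)) }
            ; inverse = (λ x → pure (-‿inverseˡ x)) , (λ x → pure (-‿inverseʳ x))
            ; ⁻¹-cong = λ x≈y → x≈y >>= λ x≈y → pure (-‿cong x≈y) }
          ; comm = λ x y → pure (+-comm x y) }
        ; *-cong = lift₂ *-cong
        ; *-assoc = λ x y z → pure (*-assoc x y z)
        ; *-identity = (λ x → pure (*-identityˡ x)) , (λ x → pure (*-identityʳ x))
        ; distrib = (λ x y z → pure (distribˡ x y z)) , (λ x y z → pure (distribʳ x y z)) }
      ; *-comm = λ x y → pure (*-comm x y) }

  F¬¬ : Field c ℓ
  F¬¬ = record
    { commutativeRing = record { isCommutativeRing = isCommutativeRing¬¬ }
    ; 1≉0     = λ 1≈0 → 1≈0 1≉0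
    ; inverse = λ x x≉0 → let (y , xy≈1) = inverse x (λ x≈0 → x≉0 (pure x≈0)) in y , pure xy≈1
    }

  private
    module LF  = LinearAlgebra F
    module L¬¬ = LinearAlgebra F¬¬

  lc-agrees : ∀ {I : Set} d cs (g : Fin d → I → Carrier) i → L¬¬.lc d cs g i ≡ LF.lc d cs g i
  lc-agrees zero    cs g i = ≡.refl
  lc-agrees (suc d) cs g i = ≡.cong (cs zero * g zero i +_) (lc-agrees d (λ k → cs (suc k)) (λ k → g (suc k)) i)

  module _ {I : Set} {q : ℕ} (E : Fin q ↔ I) where

    span-weaken : ∀ {J : Set} {g : J → I → Carrier} {v} → LF.InSpan g v → L¬¬.InSpan g v
    span-weaken {g = g} (d , cs , js , e) =
      d , cs , js , λ i → pure (trans (e i) (reflexive (≡.sym (lc-agrees d cs (λ k → g (js k)) i))))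

    span-strengthen : ∀ {J : Set} {g : J → I → Carrier} {v} → L¬¬.InSpan g v → ¬ ¬ LF.InSpan g v
    span-strengthen {g = g} (d , cs , js , e) = ¬¬-Π-finite E e >>= λ e →
      pure (d , cs , js , λ i → trans (e i) (reflexive (lc-agrees d cs (λ k → g (js k)) i)))

    transfer : ∀ {p p' d} {S : (I → Carrier) → Set p} {S' : (I → Carrier) → Set p'} →
               (∀ v → S v → S' v) → (∀ v → S' v → ¬ ¬ S v) → LF.IsDim¬¬ S d → L¬¬.IsDim¬¬ S' d
    transfer {d = d} S⊆S' S'⊆S (g , g∈S , g-ind , g-span) =
      g , (λ k → S⊆S' (g k) (g∈S k)) , g-ind¬¬ , λ v v∈S' →
        S'⊆S v v∈S' >>= λ v∈S → g-span v v∈S >>= λ v∈⟨g⟩ → pure (span-weaken {g = g} v∈⟨g⟩)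
      where
      g-ind¬¬ : L¬¬.Independent d g
      g-ind¬¬ cs vanish k = ¬¬-Π-finite E vanish >>= λ vanish →
        pure (g-ind cs (λ i → trans (reflexive (≡.sym (lc-agrees d cs g i))) (vanish i)) k)

  rank+left-nullity : ∀ {R C : Set} {p q r s} (ER : Fin p ↔ R) (EC : Fin q ↔ C) (A : R → C → Carrier) →
                      LF.IsDim¬¬ (LF.ColumnSpace A) r → LF.IsDim¬¬ (LF.Finite.Kernel ER (LF.transpose A)) s →
                      r ℕ.+ s ≡ p
  rank+left-nullity ER EC A rank left-nullity =
    L¬¬.StableEquality.rank+left-nullity negated-stable ER EC A
      (transfer ER (λ _ → span-weaken ER {g = λ y x → A x y}) (λ _ → span-strengthen ER {g = λ y x → A x y}) rank)
      (transfer ER (λ _ γ∈ker y → pure (γ∈ker y)) (λ _ γ∈ker¬¬ → ¬¬-Π-finite EC γ∈ker¬¬) left-nullity)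

module KVectors {c ℓ : Level} (F : Field c ℓ) where
  open Field F hiding (zero)
  open LinearAlgebra F
  open import Algebra.Properties.Ring ring using (-‿distribʳ-*; -‿+-comm; -‿involutive)
  open import Algebra.Properties.CommutativeSemigroup +-commutativeSemigroup using (interchange)
  open import Algebra.Properties.CommutativeSemigroup *-commutativeSemigroup using (x∙yz≈y∙xz)
  open import Relation.Binary.Reasoning.Setoid setoid

  infix 4 _≋_
  _≋_ : K F → K F → Set ℓ
  _≋_ = _≈K_ F

  ≋-sym : ∀ {u v} → u ≋ v → v ≋ u
  ≋-sym (e₁ , e₂) = sym e₁ , sym e₂

  ≋-trans : ∀ {u v w} → u ≋ v → v ≋ w → u ≋ w
  ≋-trans (e₁ , e₂) (f₁ , f₂) = trans e₁ f₁ , trans e₂ f₂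

  lcK : ∀ {I : Set} (d : ℕ) → (Fin d → Carrier) → (Fin d → I → K F) → I → K F
  lcK {I} = Lin.lc F (KMod F) {I}

  lcK-components : ∀ {I : Set} d cs (g : Fin d → I → K F) i →
                   lcK d cs g i ≋ (cs ∙ (λ k → proj₁ (g k i)) , cs ∙ (λ k → proj₂ (g k i)))
  lcK-components zero    cs g i = refl , refl
  lcK-components (suc d) cs g i =
    let (e₁ , e₂) = lcK-components d (λ k → cs (suc k)) (λ k → g (suc k)) i
    in +-cong refl e₁ , +-cong refl e₂

  lcK-cong : ∀ {I : Set} d cs {g g' : Fin d → I → K F} i → (∀ k → g k i ≋ g' k i) → lcK d cs g i ≋ lcK d cs g' i
  lcK-cong d cs {g} {g'} i e =
    ≋-trans (lcK-components d cs g i)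
      (≋-trans (∙-cong (λ _ → refl) (λ k → proj₁ (e k)) , ∙-cong (λ _ → refl) (λ k → proj₂ (e k)))
               (≋-sym (lcK-components d cs g' i)))

  form : FormType F → K F → K F → Carrier
  form = ⟨_⟩K F

  form-+ : ∀ t u v w → form t u (_+K_ F v w) ≈ form t u v + form t u w
  form-+ symm (p , q) (r , s) (r' , s') = trans (+-cong (distribˡ p s s') (distribˡ q r r')) (interchange _ _ _ _)
  form-+ skew (p , q) (r , s) (r' , s') =
    trans (+-cong (distribˡ p s s') (trans (-‿cong (distribˡ q r r')) (sym (-‿+-comm _ _)))) (interchange _ _ _ _)

  form-* : ∀ t u σ v → form t u (_·K_ F σ v) ≈ σ * form t u v
  form-* symm (p , q) σ (r , s) = trans (+-cong (x∙yz≈y∙xz p σ s) (x∙yz≈y∙xz q σ r)) (sym (distribˡ σ _ _))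
  form-* skew (p , q) σ (r , s) =
    trans (+-cong (x∙yz≈y∙xz p σ s) (trans (-‿cong (x∙yz≈y∙xz q σ r)) (-‿distribʳ-* σ _))) (sym (distribˡ σ _ _))

  form-cong : ∀ t u {v w} → v ≋ w → form t u v ≈ form t u w
  form-cong symm (p , q) (e₁ , e₂) = +-cong (*-cong refl e₂) (*-cong refl e₁)
  form-cong skew (p , q) (e₁ , e₂) = +-cong (*-cong refl e₂) (-‿cong (*-cong refl e₁))

  form-0 : ∀ t u → form t u (0K F) ≈ 0#
  form-0 symm (p , q) = trans (+-cong (zeroʳ p) (zeroʳ q)) (+-identityˡ 0#)
  form-0 skew (p , q) = trans (+-cong (zeroʳ p) (-‿cong (zeroʳ q))) (-‿inverseʳ 0#)

  form-lc : ∀ {I : Set} t (u : I → K F) d cs (g : Fin d → I → K F) i →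
            form t (u i) (lcK d cs g i) ≈ cs ∙ (λ k → form t (u i) (g k i))
  form-lc t u zero    cs g i = form-0 t (u i)
  form-lc t u (suc d) cs g i =
    trans (form-+ t (u i) _ _)
          (+-cong (form-* t (u i) (cs zero) (g zero i)) (form-lc t u d (λ k → cs (suc k)) (λ k → g (suc k)) i))

  -- if ⟨u,v⟩ = 1 then ⟨v,u⟩ is invertible (it is ±1)
  form-swap-invertible : ∀ t u v → form t u v ≈ 1# → Σ Carrier λ y → form t v u * y ≈ 1#
  form-swap-invertible symm (p , q) (r , s) uv≈1 =
    1# , trans (*-identityʳ _) (trans (+-comm _ _) (trans (+-cong (*-comm _ _) (*-comm _ _)) uv≈1))
  form-swap-invertible skew (p , q) (r , s) uv≈1 = - 1# , (begin
    (r * q + - (s * p)) * - 1#     ≈⟨ sym (-‿distribʳ-* _ 1#) ⟩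
    - ((r * q + - (s * p)) * 1#)   ≈⟨ -‿cong (*-identityʳ _) ⟩
    - (r * q + - (s * p))          ≈⟨ sym (-‿+-comm _ _) ⟩
    - (r * q) + - - (s * p)        ≈⟨ +-cong refl (-‿involutive _) ⟩
    - (r * q) + s * p              ≈⟨ +-comm _ _ ⟩
    s * p + - (r * q)              ≈⟨ +-cong (*-comm s p) (-‿cong (*-comm r q)) ⟩
    p * s + - (q * r)              ≈⟨ uv≈1 ⟩
    1#                             ∎)

  record LinearIso {I J : Set} {p} (S : (I → K F) → Set (c ⊔ ℓ)) (S' : (J → Carrier) → Set p) :
                   Set (c ⊔ ℓ ⊔ p) where
    field
      to        : (I → K F) → J → Carrier
      from      : (J → Carrier) → I → K F
      to-cong   : ∀ {v v'} → (∀ i → v i ≋ v' i) → ∀ j → to v j ≈ to v' j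
      to-lc     : ∀ d cs (g : Fin d → I → K F) j → to (lcK d cs g) j ≈ cs ∙ (λ k → to (g k) j)
      from-cong : ∀ {γ γ'} → (∀ j → γ j ≈ γ' j) → ∀ i → from γ i ≋ from γ' i
      from-lc   : ∀ d cs (γs : Fin d → J → Carrier) i →
                  from (λ j → cs ∙ (λ k → γs k j)) i ≋ lcK d cs (λ k → from (γs k)) i
      to-from   : ∀ γ j → to (from γ) j ≈ γ j
      to-∈      : ∀ v → S v → S' (to v)
      from-∈    : ∀ γ → S' γ → S (from γ)
      from-to   : ∀ v → S v → ∀ i → v i ≋ from (to v) i

  IsDim-transport : ∀ {I J : Set} {p} {S : (I → K F) → Set (c ⊔ ℓ)} {S' : (J → Carrier) → Set p} {d} →
                    LinearIso S S' → Lin.IsDim F (KMod F) S d → IsDim¬¬ S' d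
  IsDim-transport {S' = S'} {d = d} iso (g , g∈S , g-ind , g-span) =
    (λ k → to (g k)) , (λ k → to-∈ (g k) (g∈S k)) , images-independent , λ γ γ∈S' → pure (image-spans γ γ∈S')
    where
    open LinearIso iso
    images-independent : Independent d (λ k → to (g k))
    images-independent = mk-independent {g = λ k → to (g k)} λ cs vanish → g-ind cs λ i →
      ≋-trans (lcK-cong d cs i (λ k → from-to (g k) (g∈S k) i))
        (≋-trans (≋-sym (from-lc d cs (λ k → to (g k)) i))
                 (≋-trans (from-cong vanish i) (from-lc zero (λ ()) (λ ()) i)))
    image-spans : ∀ γ → S' γ → InSpan (λ k → to (g k)) γ
    image-spans γ γ∈S' with g-span (from γ) (from-∈ γ γ∈S')
    ... | (d' , cs , js , e) = d' , cs , js , λ j → begin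
      γ j                                          ≈⟨ sym (to-from γ j) ⟩
      to (from γ) j                                ≈⟨ to-cong e j ⟩
      to (lcK d' cs (λ k → g (js k))) j            ≈⟨ to-lc d' cs (λ k → g (js k)) j ⟩
      cs ∙ (λ k → to (g (js k)) j)                 ≈⟨ sym (lc≈∙ d' cs (λ k → to (g (js k))) j) ⟩
      lc d' cs (λ k → to (g (js k))) j             ∎

-- Writing a chain as
-- g(x) = α(x) a(x) + β(x) b(x), its b-coordinate is β(x) = ⟨a(x), g(x)⟩, and
-- chains of N are determined by their b-coordinates: α = βᵀ M.  Hence
-- N ≅ F^V, and N × Z is isomorphic to the space of γ ∈ F^Z with
-- Σ_{z∈Z} γ(z) M(z,w) = 0 for all w ∉ Z.
module ChainGroup {c ℓ : Level} (F : Field c ℓ) {n : ℕ} (M : Matrix F n) (t : FormType F) (a b : Chain F n)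
                  (supp : Supplementary F t a b) where
  open Field F hiding (zero)
  open LinearAlgebra F
  open KVectors F
  open import Relation.Binary.Reasoning.Setoid setoid

  N : Chain F n → Set (c ⊔ ℓ)
  N = RepGroup F M a b

  ⟪_,_⟫ : K F → K F → Carrier
  ⟪ u , v ⟫ = form t u v

  comb : Carrier → Carrier → Fin n → K F
  comb α β x = _+K_ F (_·K_ F α (a x)) (_·K_ F β (b x))

  comb-cong : ∀ {α α' β β'} x → α ≈ α' → β ≈ β' → comb α β x ≋ comb α' β' x
  comb-cong x α≈ β≈ = +-cong (*-cong α≈ refl) (*-cong β≈ refl) , +-cong (*-cong α≈ refl) (*-cong β≈ refl)

  comb-zero : ∀ {α β} x → α ≈ 0# → β ≈ 0# → comb α β x ≋ 0K F
  comb-zero x α≈0 β≈0 =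
    trans (+-cong (trans (*-cong α≈0 refl) (zeroˡ _)) (trans (*-cong β≈0 refl) (zeroˡ _))) (+-identityˡ 0#) ,
    trans (+-cong (trans (*-cong α≈0 refl) (zeroˡ _)) (trans (*-cong β≈0 refl) (zeroˡ _))) (+-identityˡ 0#)

  form-comb : ∀ (u : K F) α β x → ⟪ u , comb α β x ⟫ ≈ α * ⟪ u , a x ⟫ + β * ⟪ u , b x ⟫
  form-comb u α β x = trans (form-+ t u _ _) (+-cong (form-* t u α (a x)) (form-* t u β (b x)))

  -- pairing with a(x) reads off the b-coordinate (a, b are supplementary)
  b-coordinate : ∀ α β x → ⟪ a x , comb α β x ⟫ ≈ β
  b-coordinate α β x = begin
    ⟪ a x , comb α β x ⟫                          ≈⟨ form-comb (a x) α β x ⟩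
    α * ⟪ a x , a x ⟫ + β * ⟪ a x , b x ⟫
      ≈⟨ +-cong (trans (*-cong refl aa≈0) (zeroʳ α)) (trans (*-cong refl ab≈1) (*-identityʳ β)) ⟩
    0# + β                                        ≈⟨ +-identityˡ β ⟩
    β                                             ∎
    where
    aa≈0 : ⟪ a x , a x ⟫ ≈ 0#
    aa≈0 = proj₁ (supp x)
    ab≈1 : ⟪ a x , b x ⟫ ≈ 1#
    ab≈1 = proj₂ (proj₂ (supp x))

  -- a vanishing chain-vector has vanishing a-coordinate: pair it with b(x)
  comb≋0⇒α≈0 : ∀ α β x → comb α β x ≋ 0K F → α ≈ 0#
  comb≋0⇒α≈0 α β x comb≋0 = begin
    α                             ≈⟨ sym (trans (*-cong refl ι-inv) (*-identityʳ α)) ⟩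
    α * (⟪ b x , a x ⟫ * ι)       ≈⟨ sym (*-assoc _ _ _) ⟩
    (α * ⟪ b x , a x ⟫) * ι       ≈⟨ *-cong α⟪b,a⟫≈0 refl ⟩
    0# * ι                        ≈⟨ zeroˡ ι ⟩
    0#                            ∎
    where
    ι : Carrier
    ι = proj₁ (form-swap-invertible t (a x) (b x) (proj₂ (proj₂ (supp x))))
    ι-inv : ⟪ b x , a x ⟫ * ι ≈ 1#
    ι-inv = proj₂ (form-swap-invertible t (a x) (b x) (proj₂ (proj₂ (supp x))))
    bb≈0 : ⟪ b x , b x ⟫ ≈ 0#
    bb≈0 = proj₁ (proj₂ (supp x))
    α⟪b,a⟫≈0 : α * ⟪ b x , a x ⟫ ≈ 0#
    α⟪b,a⟫≈0 = begin
      α * ⟪ b x , a x ⟫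
        ≈⟨ sym (trans (+-cong refl (trans (*-cong refl bb≈0) (zeroʳ β))) (+-identityʳ _)) ⟩
      α * ⟪ b x , a x ⟫ + β * ⟪ b x , b x ⟫      ≈⟨ sym (form-comb (b x) α β x) ⟩
      ⟪ b x , comb α β x ⟫                       ≈⟨ form-cong t (b x) comb≋0 ⟩
      ⟪ b x , 0K F ⟫                             ≈⟨ form-0 t (b x) ⟩
      0#                                         ∎

  lcK-comb : ∀ {I : Set} (π : I → Fin n) d cs (α β : Fin d → I → Carrier) i →
             lcK d cs (λ k j → comb (α k j) (β k j) (π j)) i ≋
             comb (cs ∙ (λ k → α k i)) (cs ∙ (λ k → β k i)) (π i)
  lcK-comb π d cs α β i = ≋-trans (lcK-components d cs _ i) (component proj₁ , component proj₂)
    where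
    component : (π₀ : K F → Carrier) →
                cs ∙ (λ k → α k i * π₀ (a (π i)) + β k i * π₀ (b (π i))) ≈
                (cs ∙ (λ k → α k i)) * π₀ (a (π i)) + (cs ∙ (λ k → β k i)) * π₀ (b (π i))
    component π₀ = trans (∙-+ʳ cs _ _) (+-cong (∙-*ʳ cs _ _) (∙-*ʳ cs _ _))

  -- Coordinates of K-valued vectors on an index type I, which lies over V
  -- via π and is enumerated by E.
  module Coordinates {I : Set} {q : ℕ} (π : I → Fin n) (E : Fin q ↔ I) where
    open Inverse E using () renaming (to to enum)

    coord : (I → K F) → I → Carrier
    coord h i = ⟪ a (π i) , h i ⟫

    -- the a-coordinate at x of a chain of N with b-coordinates γ on I
    aPart : (I → Carrier) → Fin n → Carrier
    aPart γ x = (λ s → γ (enum s)) ∙ (λ s → M (π (enum s)) x)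

    chain : (I → Carrier) → I → K F
    chain γ i = comb (aPart γ (π i)) (γ i) (π i)

    chain-cong : ∀ {γ γ'} → (∀ i → γ i ≈ γ' i) → ∀ i → chain γ i ≋ chain γ' i
    chain-cong e i = comb-cong (π i) (∙-cong (λ s → e (enum s)) (λ _ → refl)) (e i)

    chain-lc : ∀ d cs (γs : Fin d → I → Carrier) i →
               chain (λ j → cs ∙ (λ k → γs k j)) i ≋ lcK d cs (λ k → chain (γs k)) i
    chain-lc d cs γs i = ≋-sym (≋-trans
      (lcK-comb π d cs (λ k j → aPart (γs k) (π j)) γs i)
      (comb-cong (π i) (∙-assoc cs (λ k s → γs k (enum s)) (λ s → M (π (enum s)) (π i))) refl))

    iso : ∀ {p} {S : (I → K F) → Set (c ⊔ ℓ)} {S' : (I → Carrier) → Set p} →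
          (∀ h → S h → S' (coord h)) → (∀ γ → S' γ → S (chain γ)) →
          (∀ h → S h → ∀ i → h i ≋ chain (coord h) i) → LinearIso S S'
    iso to-∈ from-∈ from-to = record
      { to        = coord
      ; from      = chain
      ; to-cong   = λ e i → form-cong t (a (π i)) (e i)
      ; to-lc     = form-lc t (λ i → a (π i))
      ; from-cong = chain-cong
      ; from-lc   = chain-lc
      ; to-from   = λ γ i → b-coordinate _ (γ i) (π i)
      ; to-∈      = to-∈
      ; from-∈    = from-∈
      ; from-to   = from-to
      }

  module Whole = Coordinates (λ x → x) (↔-id (Fin n))
  open Whole using (coord; aPart; chain; chain-cong; chain-lc)

  f : Fin n → Chain F n
  f = repChain F M a b

  f≋chain : ∀ i x → f i x ≋ chain (δ i) x
  f≋chain i x = ≋-trans (f≋comb i x) (comb-cong x (sym (δ-∙ i (λ y → M y x))) refl)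
    where
    f≋comb : ∀ i x → f i x ≋ comb (M i x) (δ i x) x
    f≋comb i x with i Fin.≟ x
    ... | yes ≡.refl = +-cong refl (sym (*-identityˡ _)) , +-cong refl (sym (*-identityˡ _))
    ... | no  _      = sym (trans (+-cong refl (zeroˡ _)) (+-identityʳ _)) ,
                       sym (trans (+-cong refl (zeroˡ _)) (+-identityʳ _))

  normal-form : ∀ g → N g → ∀ x → g x ≋ chain (coord g) x
  normal-form g (d , cs , js , g≋) x =
    ≋-trans (g≋ x) (≋-trans (lcK-cong d cs x (λ k → f≋chain (js k) x))
      (≋-trans (≋-sym (chain-lc d cs (λ k → δ (js k)) x)) (chain-cong (λ y → sym (coord-g y)) x)))
    where
    coord-g : ∀ y → coord g y ≈ cs ∙ (λ k → δ (js k) y)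
    coord-g y = begin
      ⟪ a y , g y ⟫                                   ≈⟨ form-cong t (a y) (g≋ y) ⟩
      ⟪ a y , lcK d cs (λ k → f (js k)) y ⟫           ≈⟨ form-lc t a d cs (λ k → f (js k)) y ⟩
      cs ∙ (λ k → ⟪ a y , f (js k) y ⟫)
        ≈⟨ ∙-cong (λ _ → refl) (λ k → trans (form-cong t (a y) (f≋chain (js k) y)) (b-coordinate _ _ y)) ⟩
      cs ∙ (λ k → δ (js k) y)                         ∎

  chain∈N : ∀ γ → N (chain γ)
  chain∈N γ = n , γ , (λ k → k) , λ x → ≋-sym
    (≋-trans (lcK-cong n γ x (λ i → f≋chain i x))
      (≋-trans (≋-sym (chain-lc n γ δ x)) (chain-cong (λ y → ∙-δ y γ) x)))

  -- N ≅ F^V, hence dim N = |V|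
  dim-N : ∀ {d} → Lin.IsDim F (KMod F) N d → d ≡ n
  dim-N hN = Finite.full-dimension (↔-id (Fin n))
    (IsDim-transport (Whole.iso {S' = λ _ → ⊤} (λ _ _ → tt) (λ γ _ → chain∈N γ) normal-form) hN) (λ _ → tt)

  -- N × Z is isomorphic to the left kernel of M[Z, V∖Z], i.e. to the kernel
  -- of its transpose (rows V∖Z, columns Z).
  module MinorOf (Z : Subset n) where
    module OnZ = Coordinates proj₁ (enumeration Z)

    aPart-supported : ∀ γ → (∀ y → y ∉ Z → γ y ≈ 0#) → ∀ x → aPart γ x ≈ OnZ.aPart (λ z → γ (proj₁ z)) x
    aPart-supported γ γ-supp x =
      sum-over-subset +-monoid Z (λ y → γ y * M y x) (λ y y∉Z → trans (*-cong (γ-supp y y∉Z) refl) (zeroˡ _))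

    extend : (Elem Z → Carrier) → Fin n → Carrier
    extend γ y with y ∈? Z
    ... | yes y∈Z = γ (y , y∈Z)
    ... | no  _   = 0#

    extend-∈ : ∀ γ z → extend γ (proj₁ z) ≈ γ z
    extend-∈ γ (y , y∈Z) with y ∈? Z
    ... | yes y∈Z' = reflexive (≡.cong (λ p → γ (y , p)) ([]=-irrelevant y∈Z' y∈Z))
    ... | no  y∉Z  = ⊥-elim (y∉Z y∈Z)

    extend-∉ : ∀ γ y → y ∉ Z → extend γ y ≈ 0#
    extend-∉ γ y y∉Z with y ∈? Z
    ... | yes y∈Z = ⊥-elim (y∉Z y∈Z)
    ... | no  _   = refl

    aPart-extend : ∀ γ x → aPart (extend γ) x ≈ OnZ.aPart γ x
    aPart-extend γ x = trans (aPart-supported (extend γ) (extend-∉ γ) x)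
                             (∙-cong (λ s → extend-∈ γ (Inverse.to (enumeration Z) s)) (λ _ → refl))

    minor-iso : LinearIso (Minor F N Z) (Finite.Kernel (enumeration Z) (transpose (subMatrix F M Z)))
    minor-iso = OnZ.iso to-∈ from-∈ from-to
      where
      coord-restriction : ∀ h g → (∀ z → h z ≋ g (proj₁ z)) → ∀ z → OnZ.coord h z ≈ coord g (proj₁ z)
      coord-restriction h g h≋g z = form-cong t (a (proj₁ z)) (h≋g z)

      coord-supported : ∀ g → (∀ y → y ∉ Z → g y ≋ 0K F) → ∀ y → y ∉ Z → coord g y ≈ 0#
      coord-supported g g-supp y y∉Z = trans (form-cong t (a y) (g-supp y y∉Z)) (form-0 t (a y))

      aPart-restriction : ∀ h g → (∀ y → y ∉ Z → g y ≋ 0K F) → (∀ z → h z ≋ g (proj₁ z)) →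
                          ∀ x → OnZ.aPart (OnZ.coord h) x ≈ aPart (coord g) x
      aPart-restriction h g g-supp h≋g x =
        trans (∙-cong (λ s → coord-restriction h g h≋g (Inverse.to (enumeration Z) s)) (λ _ → refl))
              (sym (aPart-supported (coord g) (coord-supported g g-supp) x))

      to-∈ : ∀ h → Minor F N Z h → Finite.Kernel (enumeration Z) (transpose (subMatrix F M Z)) (OnZ.coord h)
      to-∈ h (g , g∈N , g-supp , h≋g) (w , w∈∁Z) =
        trans (aPart-restriction h g g-supp h≋g w)
              (comb≋0⇒α≈0 _ _ w (≋-trans (≋-sym (normal-form g g∈N w)) (g-supp w (x∈∁p⇒x∉p w∈∁Z))))

      from-to : ∀ h → Minor F N Z h → ∀ z → h z ≋ OnZ.chain (OnZ.coord h) z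
      from-to h (g , g∈N , g-supp , h≋g) z@(y , _) =
        ≋-trans (h≋g z) (≋-trans (normal-form g g∈N y)
          (comb-cong y (sym (aPart-restriction h g g-supp h≋g y)) (sym (coord-restriction h g h≋g z))))

      from-∈ : ∀ γ → Finite.Kernel (enumeration Z) (transpose (subMatrix F M Z)) γ → Minor F N Z (OnZ.chain γ)
      from-∈ γ γ∈ker = chain (extend γ) , chain∈N (extend γ) , supported , restriction
        where
        supported : ∀ y → y ∉ Z → chain (extend γ) y ≋ 0K F
        supported y y∉Z = comb-zero y (trans (aPart-extend γ y) (γ∈ker (y , x∉p⇒x∈∁p y∉Z))) (extend-∉ γ y y∉Z)
        restriction : ∀ z → OnZ.chain γ z ≋ chain (extend γ) (proj₁ z)
        restriction z = comb-cong (proj₁ z) (sym (aPart-extend γ (proj₁ z))) (sym (extend-∈ γ z))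

    dim-minor : ∀ {d} → Lin.IsDim F (KMod F) (Minor F N Z) d →
                IsDim¬¬ (Finite.Kernel (enumeration Z) (transpose (subMatrix F M Z))) d
    dim-minor = IsDim-transport minor-iso

module Symmetry {c ℓ : Level} (F : Field c ℓ) {n : ℕ} (M : Matrix F n) where
  open Field F
  open LinearAlgebra F
  open import Algebra.Properties.Ring ring using (-1*x≈-x)

  sign : ∀ {t} → Compatible F M t → Σ Carrier λ ε → ∀ i j → M i j ≈ ε * M j i
  sign (inj₁ (symmetric , _))           = 1# , λ i j → trans (symmetric i j) (sym (*-identityˡ _))
  sign (inj₂ ((skew-symmetric , _) , _)) = - 1# , λ i j → trans (skew-symmetric i j) (sym (-1*x≈-x _))

  -- Consequently the left kernel of M[∁Z, ∁∁Z], which describes N × ∁Z, is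
  -- the kernel of M[Z, ∁Z].
  complement-kernel : ∀ {t} → Compatible F M t → (Z : Subset n) → ∀ {d} →
                      IsDim¬¬ (Finite.Kernel (enumeration (∁ Z)) (transpose (subMatrix F M (∁ Z)))) d →
                      IsDim¬¬ (Finite.Kernel (enumeration (∁ Z)) (subMatrix F M Z)) d
  complement-kernel compatible Z with sign compatible
  ... | ε , ε-sym = IsDim¬¬-cong
    (λ γ γ∈ker (x , x∈Z) → trans (scaled (λ s → ε-sym x (proj₁ (enum s))))
                                 (zero-scaled (γ∈ker (x , x∉p⇒x∈∁p (x∈p⇒x∉∁p x∈Z)))))
    (λ γ γ∈ker (w , w∈∁∁Z) → trans (scaled (λ s → ε-sym (proj₁ (enum s)) w))
                                   (zero-scaled (γ∈ker (w , x∉∁p⇒x∈p (x∈∁p⇒x∉p w∈∁∁Z)))))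
    where
    open Inverse (enumeration (∁ Z)) using () renaming (to to enum)
    scaled : ∀ {k} {γ v v' : Fin k → Carrier} → (∀ s → v s ≈ ε * v' s) → γ ∙ v ≈ (γ ∙ v') * ε
    scaled {γ = γ} {v} {v'} v≈εv' =
      trans (∙-cong (λ _ → refl) (λ s → trans (v≈εv' s) (*-comm ε (v' s)))) (∙-*ʳ γ v' ε)
    zero-scaled : ∀ {x} → x ≈ 0# → x * ε ≈ 0#
    zero-scaled x≈0 = trans (*-cong x≈0 refl) (zeroˡ ε)

open import Data.Nat using (_+_; _*_)

-- 2r + dim(N × (V∖X)) + dim(N × X) regrouped as two rank identities
regroup : ∀ r dVX dX → 2 * r + dVX + dX ≡ (r + dX) + (r + dVX)
regroup = solve-∀

theorem4p13 : ∀ {c ℓ : Level} (F : Field c ℓ) {n : ℕ}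
    (M : Matrix F n) (t : FormType F) (a b : Chain F n) →
    Compatible F M t →
    Supplementary F t a b →
    (X : Subset n) →
    (r dN dVX dX : ℕ) →
    IsRank F (subMatrix F M X) r →
    Lin.IsDim F (KMod F) {Fin n} (RepGroup F M a b) dN →
    Lin.IsDim F (KMod F) {El F (∁ X)} (Minor F (RepGroup F M a b) (∁ X)) dVX →
    Lin.IsDim F (KMod F) {El F X} (Minor F (RepGroup F M a b) X) dX →
    (2 * r + dVX + dX ≡ dN) × (r + dX ≡ ∣ X ∣)
theorem4p13 F {n} M t a b compatible supplementary X r dN dVX dX rank-r N-basis N×∁X-basis N×X-basis =
  dimension-identity , X-identity
  where
  open LinearAlgebra F using (IsDim⇒IsDim¬¬; module Finite)
  open ChainGroup F M t a b supplementary using (dim-N; module MinorOf)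
  open Symmetry F M using (complement-kernel)
  open ≡.≡-Reasoning

  rank : LinearAlgebra.IsDim¬¬ F (LinearAlgebra.ColumnSpace F (subMatrix F M X)) r
  rank = IsDim⇒IsDim¬¬ rank-r

  -- rank M[X, V∖X] + dim (N × X) = |X|: N × X is the left kernel of M[X, V∖X]
  X-identity : r + dX ≡ ∣ X ∣
  X-identity = DoubleNegationField.rank+left-nullity F (enumeration X) (enumeration (∁ X)) (subMatrix F M X)
                 rank (MinorOf.dim-minor X N×X-basis)

  -- rank M[X, V∖X] + dim (N × (V∖X)) = |V∖X|: N × (V∖X) is its kernel
  ∁X-identity : r + dVX ≡ ∣ ∁ X ∣
  ∁X-identity = Finite.rank-nullity (enumeration (∁ X)) (subMatrix F M X) rank
                  (complement-kernel compatible X (MinorOf.dim-minor (∁ X) N×∁X-basis))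

  dimension-identity : 2 * r + dVX + dX ≡ dN
  dimension-identity = begin
    2 * r + dVX + dX          ≡⟨ regroup r dVX dX ⟩
    (r + dX) + (r + dVX)      ≡⟨ ≡.cong₂ _+_ X-identity ∁X-identity ⟩
    ∣ X ∣ + ∣ ∁ X ∣           ≡⟨ ∣Z∣+∣∁Z∣≡n X ⟩
    n                         ≡⟨ ≡.sym (dim-N N-basis) ⟩
    dN                        ∎
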